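{- For every rational $u$, let $p = (3u^2+2)(9u^2+1)$, $q = 2u(u^2-1)^2$, $r = (3u^2+2)(1-u^2)$, $s = 10u(4u^2+1)$ and $a = \frac{1-u^4}{5}$. Then $pq(p^2+q^2) = a\,rs(r^2+s^2)$; equivalently $A=p+q$, $B=r-s$, $C=p-q$, $D=r+s$ satisfy $A^4 + aB^4 = C^4 + aD^4$. -}

module Defs where

open import Data.Integer using (ℤ)
open import Data.Rational using (ℚ; _+_; _-_; _*_; _/_; 0ℚ; 1ℚ)

k : ℤ → ℚ
k n = n / 1

sq : ℚ → ℚ
sq x = x * x

pow4 : ℚ → ℚ
pow4 x = sq x * sq x

P Q R S Aco : ℚ → ℚ
P u = (k (ℤ.pos 3) * sq u + k (ℤ.pos 2)) * (k (ℤ.pos 9) * sq u + 1ℚ)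
Q u = k (ℤ.pos 2) * u * sq (sq u - 1ℚ)
R u = (k (ℤ.pos 3) * sq u + k (ℤ.pos 2)) * (1ℚ - sq u)
S u = k (ℤ.pos 10) * u * (k (ℤ.pos 4) * sq u + 1ℚ)
Aco u = (1ℚ - pow4 u) * (ℤ.pos 1 / 5)

-- Proof idea.
-- The second, A⁴ + a B⁴ = C⁴ + a D⁴ with A = p + q, B = r - s, C = p - q,
-- D = r + s, is not verified separately: it follows from the first for
-- arbitrary p, q, r, s, a through the binomial expansion
--   (x + y)⁴ = (x - y)⁴ + 8 x y (x² + y²),
-- which turns each side of the quartic identity into the other side plus
-- 8 times one side of the first identity.
module Submission where

open import Defs
open import Data.Rational using (ℚ; _+_; _-_; _*_; _/_; 1ℚ)
open import Data.Integer using (ℤ)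
open import Relation.Binary.PropositionalEquality using (_≡_; refl; cong; sym; module ≡-Reasoning)
open import Data.Product using (_×_; _,_)
open import Data.Rational.Solver using (module +-*-Solver)
open +-*-Solver

eight : ℚ
eight = k (ℤ.pos 8)

sqᴾ : ∀ {n} → Polynomial n → Polynomial n
sqᴾ x = x :* x

pow4ᴾ : ∀ {n} → Polynomial n → Polynomial n
pow4ᴾ x = sqᴾ x :* sqᴾ x

-- Binomial expansion: (x + y)⁴ and (x - y)⁴ differ exactly by 8xy(x² + y²),
-- since the odd-degree terms in y are the only ones that change sign.
fourthPowerGap : ∀ x y → pow4 (x + y) ≡ pow4 (x - y) + eight * (x * y * (sq x + sq y))
fourthPowerGap = solve 2
  (λ x y → pow4ᴾ (x :+ y) := pow4ᴾ (x :- y) :+ con eight :* (x :* y :* (sqᴾ x :+ sqᴾ y)))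
  refl

regroup : ∀ c a b r s g → (c + eight * (a * r * s * g)) + a * b ≡ c + a * (b + eight * (r * s * g))
regroup = solve 6
  (λ c a b r s g → (c :+ con eight :* (a :* r :* s :* g)) :+ a :* b
                := c :+ a :* (b :+ con eight :* (r :* s :* g)))
  refl

quarticFromProductIdentity : ∀ p q r s a →
  p * q * (sq p + sq q) ≡ a * r * s * (sq r + sq s) →
  pow4 (p + q) + a * pow4 (r - s) ≡ pow4 (p - q) + a * pow4 (r + s)
quarticFromProductIdentity p q r s a productIdentity = begin
  pow4 (p + q) + a * pow4 (r - s)
    ≡⟨ cong (_+ a * pow4 (r - s)) (fourthPowerGap p q) ⟩
  (pow4 (p - q) + eight * (p * q * (sq p + sq q))) + a * pow4 (r - s)
    ≡⟨ cong (λ t → (pow4 (p - q) + eight * t) + a * pow4 (r - s)) productIdentity ⟩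
  (pow4 (p - q) + eight * (a * r * s * (sq r + sq s))) + a * pow4 (r - s)
    ≡⟨ regroup (pow4 (p - q)) a (pow4 (r - s)) r s (sq r + sq s) ⟩
  pow4 (p - q) + a * (pow4 (r - s) + eight * (r * s * (sq r + sq s)))
    ≡⟨ cong (λ t → pow4 (p - q) + a * t) (sym (fourthPowerGap r s)) ⟩
  pow4 (p - q) + a * pow4 (r + s) ∎
  where open ≡-Reasoning

parametrisationIdentity : ∀ u → P u * Q u * (sq (P u) + sq (Q u)) ≡ Aco u * R u * S u * (sq (R u) + sq (S u))
parametrisationIdentity = solve 1
  (λ u → Pᴾ u :* Qᴾ u :* (sqᴾ (Pᴾ u) :+ sqᴾ (Qᴾ u))
      := Acoᴾ u :* Rᴾ u :* Sᴾ u :* (sqᴾ (Rᴾ u) :+ sqᴾ (Sᴾ u)))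
  refl
  where
  c : ℤ → Polynomial 1
  c n = con (k n)
  one : Polynomial 1
  one = con 1ℚ
  Pᴾ Qᴾ Rᴾ Sᴾ Acoᴾ : Polynomial 1 → Polynomial 1
  Pᴾ u = (c (ℤ.pos 3) :* sqᴾ u :+ c (ℤ.pos 2)) :* (c (ℤ.pos 9) :* sqᴾ u :+ one)
  Qᴾ u = c (ℤ.pos 2) :* u :* sqᴾ (sqᴾ u :- one)
  Rᴾ u = (c (ℤ.pos 3) :* sqᴾ u :+ c (ℤ.pos 2)) :* (one :- sqᴾ u)
  Sᴾ u = c (ℤ.pos 10) :* u :* (c (ℤ.pos 4) :* sqᴾ u :+ one)
  Acoᴾ u = (one :- pow4ᴾ u) :* con (ℤ.pos 1 / 5)

mainTheorem13 : (u : ℚ) →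
    (P u * Q u * (sq (P u) + sq (Q u)) ≡ Aco u * R u * S u * (sq (R u) + sq (S u)))
    × (pow4 (P u + Q u) + Aco u * pow4 (R u - S u) ≡ pow4 (P u - Q u) + Aco u * pow4 (R u + S u))
mainTheorem13 u =
  parametrisationIdentity u ,
  quarticFromProductIdentity (P u) (Q u) (R u) (S u) (Aco u) (parametrisationIdentity u)
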